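{- Let $B$ be a simplified, minimally unsettled branch that has at least three child branches which are $1$-branches. Then $B$ admits a $4/3$-approximate tour set.
   Context: Instance of splittable Capacitated Vehicle Routing on a tree $T$ rooted at the depot $r$, edge lengths $l(e)\ge0$, vertex demands $d(v)\ge0$, demands scaled so that vehicle capacity is $Q=1$. A tour is a closed walk from $r$ covering at most $1$ unit of demand, only at vertices it visits; demand may be split among tours. An edge $(u,v)$ means $u$ is the parent of $v$; $T_v$ is the subtree rooted at $v$, $d(T_v)$ its total demand; $P[u,v]$ the tree path, $l(P[u,v])$ its length. Traffic $f((u,v))=\lceil d(T_v)\rceil$; $LB=\sum_e 2l(e)f(e)$ for the current demands. A nonempty set of tours is a $4/3$-approximate tour set if its total length is at most $4/3$ times the reduction of $LB$ obtained by removing the demand it covers; "$B$ admits" such a set means one exists covering demand of $B$. If $v$ has parent $u$, $T_v\cup\{(u,v)\}$ is a branch at $u$ with stem $(u,v)$; a $p$-branch if $f((u,v))=p$; its child branches are the branches at $v$. Simplified: no internal vertex has positive demand, no non-root vertex has degree two, every leaf has demand strictly between $0$ and $1$, and none of the following is applicable: (condense) an edge $(u,v)$ with traffic $1$ and $v$ not a leaf; (unzip) an edge $(u,v)$ whose traffic equals the sum of traffics of all edges from $v$ to its children; (group) a vertex with at least four children, three of them leaves $v_1,v_2,v_3$ with $1.5<d(v_1)+d(v_2)+d(v_3)<2$; (unite) a vertex with two leaf children $v_1,v_2$ with $d(v_1)+d(v_2)\le1$; (slide) an edge $(u,v)$ and child edges $(v,w_1),(v,w_2)$ with $f((u,v))=f((v,w_1))$.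 A branch is simplified if these conditions hold within it. A 2-chain is a simplified 2-branch with stem $(u,v)$ where $v$ has exactly three children, all leaves, with total demand in $(1.5,2]$. For $p\ge3$ a $p$-chain is a simplified $p$-branch with stem $(u,v)$ where $v$ has exactly three children $w_1,w_2,w_3$, $w_2,w_3$ leaves with $1<d(w_2)+d(w_3)\le1.5$, and $(v,w_1)$ the stem of a $(p-1)$-chain. All 2-chains are long; a $p$-chain ($p\ge3$) is long if $\min\{l((v,w_2)),l((v,w_3))\}<l(P[v,r])$ and its $(p-1)$-chain is long. A branch is settled if it is a 1-branch or a long $p$-chain, unsettled otherwise, and minimally unsettled if it is unsettled and all its child branches are settled.
   Formalization: The edge lengths $l(e)$ and the vertex demands $d(v)$ are rational, and the portions of demand covered by the tours are likewise taken in the rationals. -}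

module Defs where

open import Data.Nat as ℕ using (ℕ; zero; suc)
open import Data.Integer as ℤ using (ℤ)
open import Data.Rational using (ℚ; 0ℚ; _+_; _*_; _-_; _≤_; _<_; _/_; _⊓_)
open import Data.Rational.Base using (ceiling)
open import Data.Fin using (Fin; zero; suc)
open import Data.Fin.Properties using (_≟_)
open import Data.List using (List; []; _∷_; map; filter; length; foldr; head; last)
open import Data.List.Relation.Unary.Any using (Any; any?)
open import Data.List.Membership.Propositional using (_∈_)
open import Data.List.Relation.Unary.Linked using (Linked)
open import Data.Maybe using (Maybe; just)
open import Data.Product using (Σ; ∃; _×_; _,_)
open import Data.Sum using (_⊎_)
open import Data.Empty using (⊥)
open import Relation.Nullary using (¬_; yes; no)
open import Relation.Binary.PropositionalEquality using (_≡_; _≢_)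
open import Data.Fin.Base using (toℕ)
open import Data.List.Base using (allFin)

-- Instances of splittable CVRP on a tree (capacity Q = 1), with
-- rational lengths and demands.
-- Vertices are  Fin (suc n) , the depot/root r is  zero .
-- The non-root vertex  suc i  has parent  par i , where the index of the
-- parent is smaller (this encodes an arbitrary rooted tree: label the
-- vertices in BFS order).  len i  is the length of the edge
-- (par i , suc i).  dem v  is the demand of vertex v.

record Instance (n : ℕ) : Set where
  field
    par    : Fin n → Fin (suc n)
    par<   : ∀ i → toℕ (par i) ℕ.≤ toℕ i
    len    : Fin n → ℚ
    len≥0  : ∀ i → 0ℚ ≤ len i
    dem    : Fin (suc n) → ℚ
    dem≥0  : ∀ v → 0ℚ ≤ dem v

sumℚ : List ℚ → ℚ
sumℚ = foldr _+_ 0ℚ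

sumℤ : List ℤ → ℤ
sumℤ = foldr ℤ._+_ (ℤ.+ 0)

ℤ→ℚ : ℤ → ℚ
ℤ→ℚ z = z / 1

module _ {n : ℕ} (I : Instance n) where
  open Instance I

  V : Set
  V = Fin (suc n)

  -- list of vertices from v up to the root (fuel n suffices since
  -- parent indices strictly decrease)
  up : ℕ → V → List V
  up zero v = v ∷ []
  up (suc k) zero = zero ∷ []
  up (suc k) (suc i) = suc i ∷ up k (par i)

  pathToRoot : V → List V
  pathToRoot v = up n v

  InT : V → V → Set
  InT x y = x ∈ pathToRoot y

  stemLen : V → ℚ
  stemLen zero = 0ℚ
  stemLen (suc i) = len i

  pathLen : V → ℚ
  pathLen v = sumℚ (map stemLen (pathToRoot v))

  subDem : (V → ℚ) → V → ℚ
  subDem d x = sumℚ (map (λ y → d y) (filter (λ y → any? (x ≟_) (pathToRoot y)) (allFin (suc n))))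

  -- traffic of the edge into v (for the root: unused, set to 0)
  traffic : (V → ℚ) → V → ℤ
  traffic d zero = ℤ.+ 0
  traffic d (suc i) = ceiling (subDem d (suc i))

  LB : (V → ℚ) → ℚ
  LB d = sumℚ (map (λ i → ((ℤ.+ 2) / 1) * len i * ℤ→ℚ (traffic d (suc i))) (allFin n))

  IsChild : V → V → Set
  IsChild w x = ∃ λ i → w ≡ suc i × par i ≡ x

  childIdx : V → List (Fin n)
  childIdx x = filter (λ i → par i ≟ x) (allFin n)

  numChildren : V → ℕ
  numChildren x = length (childIdx x)

  IsLeaf : V → Set
  IsLeaf x = ∀ w → ¬ IsChild w x

  Adj : V → V → Set
  Adj a b = IsChild a b ⊎ IsChild b a

  edgeLen : V → V → ℚ
  edgeLen (suc i) b with par i ≟ b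
  ... | yes _ = len i
  ... | no _ = edgeLen' b
    where
    edgeLen' : V → ℚ
    edgeLen' zero = 0ℚ
    edgeLen' (suc j) with par j ≟ suc i
    ... | yes _ = len j
    ... | no _ = 0ℚ
  edgeLen zero zero = 0ℚ
  edgeLen zero (suc j) with par j ≟ zero
  ... | yes _ = len j
  ... | no _ = 0ℚ

  walkLen : List V → ℚ
  walkLen (a ∷ b ∷ xs) = edgeLen a b + walkLen (b ∷ xs)
  walkLen _ = 0ℚ

  record Tour : Set where
    field
      walk      : List V
      startsAtr : head walk ≡ just zero
      endsAtr   : last walk ≡ just zero
      isWalk    : Linked Adj walk
      cover     : V → ℚ
      cover≥0   : ∀ x → 0ℚ ≤ cover x
      cover≤1   : sumℚ (map cover (allFin (suc n))) ≤ (ℤ.+ 1) / 1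
      visited   : ∀ x → 0ℚ < cover x → x ∈ walk

  open Tour

  totalCover : List Tour → V → ℚ
  totalCover ts x = sumℚ (map (λ t → cover t x) ts)

  totalLen : List Tour → ℚ
  totalLen ts = sumℚ (map (λ t → walkLen (walk t)) ts)

  -- the branch with stem (par i, v) admits a 4/3-approximate tour set
  Admits : V → Set
  Admits v = Σ (List Tour) λ ts →
      ts ≢ []
    × (∀ t → t ∈ ts → ∀ x → 0ℚ < cover t x → InT v x)
    × (∀ x → totalCover ts x ≤ dem x)
    × (∃ λ x → 0ℚ < totalCover ts x)
    × (totalLen ts ≤ ((ℤ.+ 4) / 3) * (LB dem - LB (λ x → dem x - totalCover ts x)))

  Simplified : V → Set
  Simplified v =
      (∀ x → InT v x → ¬ IsLeaf x → dem x ≡ 0ℚ)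
    × (∀ x → InT v x → numChildren x ≢ 1)
    × (∀ x → InT v x → IsLeaf x → 0ℚ < dem x × dem x < (ℤ.+ 1) / 1)
    -- condense
    × (∀ x → InT v x → traffic dem x ≡ ℤ.+ 1 → IsLeaf x)
    -- unzip
    × (∀ x → InT v x → traffic dem x ≢ sumℤ (map (λ j → traffic dem (suc j)) (childIdx x)))
    -- group
    × (∀ x → InT v x → 4 ℕ.≤ numChildren x → ∀ w₁ w₂ w₃ →
         IsChild w₁ x → IsChild w₂ x → IsChild w₃ x →
         IsLeaf w₁ → IsLeaf w₂ → IsLeaf w₃ → w₁ ≢ w₂ → w₁ ≢ w₃ → w₂ ≢ w₃ →
         ¬ ((ℤ.+ 3) / 2 < dem w₁ + dem w₂ + dem w₃ × dem w₁ + dem w₂ + dem w₃ < (ℤ.+ 2) / 1))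
    -- unite
    × (∀ x → InT v x → ∀ w₁ w₂ → IsChild w₁ x → IsChild w₂ x →
         IsLeaf w₁ → IsLeaf w₂ → w₁ ≢ w₂ → ¬ (dem w₁ + dem w₂ ≤ (ℤ.+ 1) / 1))
    -- slide
    × (∀ y → InT v y → ∀ w₁ w₂ → IsChild w₁ y → IsChild w₂ y → w₁ ≢ w₂ →
         traffic dem y ≢ traffic dem w₁)

  ExactlyChildren : V → V → V → V → Set
  ExactlyChildren v w₁ w₂ w₃ =
    w₁ ≢ w₂ × w₁ ≢ w₃ × w₂ ≢ w₃ ×
    (∀ w → IsChild w v → w ≡ w₁ ⊎ w ≡ w₂ ⊎ w ≡ w₃) ×
    IsChild w₁ v × IsChild w₂ v × IsChild w₃ v

  Chain : ℕ → V → Set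
  Chain zero v = ⊥
  Chain (suc zero) v = ⊥
  Chain (suc (suc zero)) v =
    Simplified v × traffic dem v ≡ ℤ.+ 2 ×
    ∃ λ w₁ → ∃ λ w₂ → ∃ λ w₃ → ExactlyChildren v w₁ w₂ w₃ ×
      IsLeaf w₁ × IsLeaf w₂ × IsLeaf w₃ ×
      (ℤ.+ 3) / 2 < dem w₁ + dem w₂ + dem w₃ × dem w₁ + dem w₂ + dem w₃ ≤ (ℤ.+ 2) / 1
  Chain (suc (suc (suc k))) v =
    Simplified v × traffic dem v ≡ ℤ.+ (suc (suc (suc k))) ×
    ∃ λ w₁ → ∃ λ w₂ → ∃ λ w₃ → ExactlyChildren v w₁ w₂ w₃ ×
      IsLeaf w₂ × IsLeaf w₃ ×
      (ℤ.+ 1) / 1 < dem w₂ + dem w₃ × dem w₂ + dem w₃ ≤ (ℤ.+ 3) / 2 ×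
      Chain (suc (suc k)) w₁

  LongChain : ℕ → V → Set
  LongChain zero v = ⊥
  LongChain (suc zero) v = ⊥
  LongChain (suc (suc zero)) v = Chain 2 v
  LongChain (suc (suc (suc k))) v =
    Simplified v × traffic dem v ≡ ℤ.+ (suc (suc (suc k))) ×
    ∃ λ w₁ → ∃ λ w₂ → ∃ λ w₃ → ExactlyChildren v w₁ w₂ w₃ ×
      IsLeaf w₂ × IsLeaf w₃ ×
      (ℤ.+ 1) / 1 < dem w₂ + dem w₃ × dem w₂ + dem w₃ ≤ (ℤ.+ 3) / 2 ×
      (stemLen w₂ ⊓ stemLen w₃) < pathLen v ×
      LongChain (suc (suc k)) w₁

  Settled : V → Set
  Settled v = traffic dem v ≡ ℤ.+ 1 ⊎ ∃ λ p → LongChain p v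

  MinimallyUnsettled : V → Set
  MinimallyUnsettled v = ¬ Settled v × (∀ w → IsChild w v → Settled w)

  ThreeOneBranchChildren : V → Set
  ThreeOneBranchChildren v =
    ∃ λ w₁ → ∃ λ w₂ → ∃ λ w₃ →
      w₁ ≢ w₂ × w₁ ≢ w₃ × w₂ ≢ w₃ ×
      IsChild w₁ v × IsChild w₂ v × IsChild w₃ v ×
      traffic dem w₁ ≡ ℤ.+ 1 × traffic dem w₂ ≡ ℤ.+ 1 × traffic dem w₃ ≡ ℤ.+ 1

-- Let v be the lower end of the stem of B and Q = l(P[v,r]).  The three 1-branch children w₁, w₂, w₃ of v
-- are leaves with demands in (0,1) (condense), any two of them carry more than one unit (unite), so
-- S = d(w₁) + d(w₂) + d(w₃) > 3/2.  In fact S ≥ 2: with four or more children this is the failure of group;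
-- with exactly three, the traffic into v is ⌈S⌉, which is either 2 (then B is a 2-chain, hence settled) or
-- 3 (then unzip applies).
-- Write lⱼ = l((v,wⱼ)).  If 3 lₘ ≤ Q for some m, a single tour that serves another leaf wₒ completely and
-- wₘ with the rest of its capacity costs 2(Q + lₒ + lₘ), while LB drops by at least 2(Q + lₒ).  Otherwise
-- Q ≤ l₁ + l₂ + l₃, and one tour per leaf costs 6Q + 2(l₁ + l₂ + l₃), while LB drops by at least
-- 2(2Q + l₁ + l₂ + l₃) because at least two units of demand leave T_v.  Both ratios are at most 4/3.

module Submission where

open import Data.Nat as ℕ using (ℕ; zero; suc; z≤n; s≤s)
import Data.Nat.Properties as ℕP
import Data.Integer as ℤ
import Data.Integer.Properties as ℤP
import Data.Integer.DivMod as ℤD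
open import Data.Rational as ℚ
  using (ℚ; mkℚ; 0ℚ; 1ℚ; _+_; _*_; _-_; -_; _≤_; _<_; _/_; ceiling; floor; *≤*; *<*)
import Data.Rational.Properties as ℚP
import Data.Rational.Unnormalised as ℚᵘ
import Data.Rational.Unnormalised.Properties as ℚᵘP
import Data.Nat.Coprimality as Coprime
open import Data.Fin using (Fin; zero; suc; toℕ)
open import Data.Fin.Properties using (_≟_; toℕ<n)
open import Data.List using (List; []; _∷_; map; filter; length; head; last; tabulate)
open import Data.List.Base using (allFin)
import Data.List.Properties as ListP
open import Data.List.Relation.Unary.Any using (here; there; any?; index; _─_)
open import Data.List.Relation.Unary.All as All using (All; []; _∷_; lookup)
open import Data.List.Relation.Unary.AllPairs using (AllPairs; []; _∷_)
open import Data.List.Relation.Unary.Linked using (Linked; []; [-]; _∷_)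
open import Data.List.Membership.Propositional using (_∈_; _∉_)
open import Data.List.Membership.Propositional.Properties using (∈-map⁺; ∈-filter⁺; ∈-filter⁻; ∈-allFin)
import Data.List.Membership.DecPropositional as DecMembership
open import Data.Bool using (true; false; if_then_else_)
open import Data.Maybe using (Maybe; just; nothing)
open import Data.Product using (∃; _×_; _,_; proj₁; proj₂)
open import Data.Sum using (_⊎_; inj₁; inj₂)
open import Data.Empty using (⊥; ⊥-elim)
open import Function using (_∘_; id)
open import Relation.Nullary using (Dec; yes; no; does; ¬_)
open import Relation.Unary using (Pred; Decidable)
open import Relation.Binary.PropositionalEquality
open import Algebra.Bundles using (CommutativeRing)
open import Algebra.Properties.Semiring.Sum (CommutativeRing.semiring ℚP.+-*-commutativeRing)
  using (sum; ∑-distrib-+; *-distribˡ-sum; sum-cong-≗; sum-replicate-zero)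
import Tactic.RingSolver.Core.AlmostCommutativeRing as ACR
open import Tactic.RingSolver using (solve-∀)
open import Level using (0ℓ)
open import Defs

-- Rational arithmetic and ceilings

ℚ-ring : ACR.AlmostCommutativeRing 0ℓ 0ℓ
ℚ-ring = ACR.fromCommutativeRing ℚP.+-*-commutativeRing isZero
  where
  isZero : (x : ℚ) → Maybe (0ℚ ≡ x)
  isZero x with 0ℚ ℚP.≟ x
  ... | yes p = just p
  ... | no _ = nothing

p≤q⇒0≤q-p : ∀ {p q} → p ≤ q → 0ℚ ≤ q - p
p≤q⇒0≤q-p {p} {q} p≤q = subst (_≤ q - p) (ℚP.+-inverseʳ p) (ℚP.+-monoˡ-≤ (- p) p≤q)

p<q⇒0<q-p : ∀ {p q} → p < q → 0ℚ < q - p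
p<q⇒0<q-p {p} {q} p<q = subst (_< q - p) (ℚP.+-inverseʳ p) (ℚP.+-monoˡ-< (- p) p<q)

q-p+p≡q : ∀ p q → q - p + p ≡ q
q-p+p≡q = solve-∀ ℚ-ring

≤-from-difference : ∀ {p q e} → q - p ≡ e → 0ℚ ≤ e → p ≤ q
≤-from-difference {p} {q} q-p≡e 0≤e =
  subst₂ _≤_ (ℚP.+-identityˡ p) (q-p+p≡q p q) (ℚP.+-monoˡ-≤ p (subst (0ℚ ≤_) (sym q-p≡e) 0≤e))

<-from-difference : ∀ {p q e} → q - p ≡ e → 0ℚ < e → p < q
<-from-difference {p} {q} q-p≡e 0<e =
  subst₂ _<_ (ℚP.+-identityˡ p) (q-p+p≡q p q) (ℚP.+-monoˡ-< p (subst (0ℚ <_) (sym q-p≡e) 0<e))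

nonNeg*nonNeg : ∀ {p q} → 0ℚ ≤ p → 0ℚ ≤ q → 0ℚ ≤ p * q
nonNeg*nonNeg {p} {q} 0≤p 0≤q =
  subst (_≤ p * q) (ℚP.*-zeroˡ q) (ℚP.*-monoʳ-≤-nonNeg q {{ℚ.nonNegative 0≤q}} 0≤p)

2ℚ : ℚ
2ℚ = ℤ.+ 2 / 1

0≤2ℚ : 0ℚ ≤ 2ℚ
0≤2ℚ = ℚP.≤ᵇ⇒≤ _

ℤ→ℚ-mkℚ : ∀ z → ℤ→ℚ z ≡ mkℚ z 0 (Coprime.sym (Coprime.1-coprimeTo ℤ.∣ z ∣))
ℤ→ℚ-mkℚ (ℤ.+ n) = ℚP.normalize-coprime (Coprime.sym (Coprime.1-coprimeTo n))
ℤ→ℚ-mkℚ ℤ.-[1+ n ] = cong -_ (ℚP.normalize-coprime (Coprime.sym (Coprime.1-coprimeTo (suc n))))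

ℤ→ℚ-mono-≤ : ∀ {a b} → a ℤ.≤ b → ℤ→ℚ a ≤ ℤ→ℚ b
ℤ→ℚ-mono-≤ {a} {b} a≤b rewrite ℤ→ℚ-mkℚ a | ℤ→ℚ-mkℚ b =
  *≤* (subst₂ ℤ._≤_ (sym (ℤP.*-identityʳ a)) (sym (ℤP.*-identityʳ b)) a≤b)

ℤ→ℚ-cancel-< : ∀ {a b} → ℤ→ℚ a < ℤ→ℚ b → a ℤ.< b
ℤ→ℚ-cancel-< {a} {b} a<b rewrite ℤ→ℚ-mkℚ a | ℤ→ℚ-mkℚ b with a<b
... | *<* a*1<b*1 = subst₂ ℤ._<_ (ℤP.*-identityʳ a) (ℤP.*-identityʳ b) a*1<b*1

ℤ→ℚ-+ : ∀ a b → ℤ→ℚ (a ℤ.+ b) ≡ ℤ→ℚ a + ℤ→ℚ b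
ℤ→ℚ-+ a b = ℚP.toℚᵘ-injective
  (ℚᵘP.≃-trans unnormalised (ℚᵘP.≃-sym (ℚP.toℚᵘ-homo-+ (ℤ→ℚ a) (ℤ→ℚ b))))
  where
  unnormalised : ℚ.toℚᵘ (ℤ→ℚ (a ℤ.+ b)) ℚᵘ.≃ ℚ.toℚᵘ (ℤ→ℚ a) ℚᵘ.+ ℚ.toℚᵘ (ℤ→ℚ b)
  unnormalised rewrite ℤ→ℚ-mkℚ (a ℤ.+ b) | ℤ→ℚ-mkℚ a | ℤ→ℚ-mkℚ b =
    ℚᵘ.*≡* (cong (ℤ._* ℤ.+ 1) (sym (cong₂ ℤ._+_ (ℤP.*-identityʳ a) (ℤP.*-identityʳ b))))

ℤ→ℚ-neg : ∀ a → ℤ→ℚ (ℤ.- a) ≡ - ℤ→ℚ a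
ℤ→ℚ-neg a = ℚP.toℚᵘ-injective
  (ℚᵘP.≃-trans unnormalised (ℚᵘP.≃-sym (ℚP.toℚᵘ-homo‿- (ℤ→ℚ a))))
  where
  unnormalised : ℚ.toℚᵘ (ℤ→ℚ (ℤ.- a)) ℚᵘ.≃ ℚᵘ.- ℚ.toℚᵘ (ℤ→ℚ a)
  unnormalised rewrite ℤ→ℚ-mkℚ (ℤ.- a) | ℤ→ℚ-mkℚ a = ℚᵘ.*≡* refl

ℤ→ℚ-- : ∀ a b → ℤ→ℚ (a ℤ.- b) ≡ ℤ→ℚ a - ℤ→ℚ b
ℤ→ℚ-- a b = trans (ℤ→ℚ-+ a (ℤ.- b)) (cong (λ x → ℤ→ℚ a + x) (ℤ→ℚ-neg b))

ℤ→ℚ-suc : ∀ a → ℤ→ℚ (ℤ.suc a) ≡ ℤ→ℚ a + 1ℚ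
ℤ→ℚ-suc a = trans (cong ℤ→ℚ (ℤP.+-comm (ℤ.+ 1) a)) (ℤ→ℚ-+ a (ℤ.+ 1))

⌊p⌋≤p : ∀ p → ℤ→ℚ (floor p) ≤ p
⌊p⌋≤p p@(mkℚ num d-1 _) rewrite ℤ→ℚ-mkℚ (floor p) =
  *≤* (subst (λ x → floor p ℤ.* ℤ.+ suc d-1 ℤ.≤ x) (sym (ℤP.*-identityʳ num))
        (ℤD.[n/d]*d≤n num (ℤ.+ suc d-1)))

p<⌊p⌋+1 : ∀ p → p < ℤ→ℚ (floor p) + 1ℚ
p<⌊p⌋+1 p@(mkℚ num d-1 _) = subst (p <_) (ℤ→ℚ-suc (floor p)) p<1+⌊p⌋
  where
  p<1+⌊p⌋ : p < ℤ→ℚ (ℤ.suc (floor p))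
  p<1+⌊p⌋ rewrite ℤ→ℚ-mkℚ (ℤ.suc (floor p)) =
    *<* (subst₂ ℤ._<_ (sym (ℤP.*-identityʳ num))
          (cong (λ q → ℤ.suc q ℤ.* ℤ.+ suc d-1) (sym (ℤD.div-pos-is-/ℕ num (suc d-1))))
          (ℤD.n<s[n/ℕd]*d num (suc d-1)))

-- ceiling p is defined as - floor (- p).
p≤⌈p⌉ : ∀ p → p ≤ ℤ→ℚ (ceiling p)
p≤⌈p⌉ p@record{} =
  ≤-from-difference (trans (cong (_- p) (ℤ→ℚ-neg (floor (- p)))) (swap (ℤ→ℚ (floor (- p))) p))
    (p≤q⇒0≤q-p (⌊p⌋≤p (- p)))
  where
  swap : ∀ a b → - a - b ≡ - b - a
  swap = solve-∀ ℚ-ring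

⌈p⌉<p+1 : ∀ p → ℤ→ℚ (ceiling p) < p + 1ℚ
⌈p⌉<p+1 p@record{} =
  <-from-difference (trans (cong (λ c → p + 1ℚ - c) (ℤ→ℚ-neg (floor (- p)))) (swap (ℤ→ℚ (floor (- p))) p))
    (p<q⇒0<q-p (p<⌊p⌋+1 (- p)))
  where
  swap : ∀ a b → b + 1ℚ - - a ≡ a + 1ℚ - - b
  swap = solve-∀ ℚ-ring

i<1+j⇒i≤j : ∀ {a b} → a ℤ.< ℤ.suc b → a ℤ.≤ b
i<1+j⇒i≤j {a} {b} a<1+b = subst (a ℤ.≤_) (ℤP.pred-suc b) (ℤP.i<j⇒i≤pred[j] a<1+b)

ceiling-least : ∀ p c → p ≤ ℤ→ℚ c → ceiling p ℤ.≤ c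
ceiling-least p c p≤c = i<1+j⇒i≤j (ℤ→ℚ-cancel-< (subst (ℤ→ℚ (ceiling p) <_) (sym (ℤ→ℚ-suc c))
  (ℚP.<-≤-trans (⌈p⌉<p+1 p) (ℚP.+-monoˡ-≤ 1ℚ p≤c))))

ceiling-greatest : ∀ p c → ℤ→ℚ c < p + 1ℚ → c ℤ.≤ ceiling p
ceiling-greatest p c c<p+1 = i<1+j⇒i≤j (ℤ→ℚ-cancel-< (subst (ℤ→ℚ c <_) (sym (ℤ→ℚ-suc (ceiling p)))
  (ℚP.<-≤-trans c<p+1 (ℚP.+-monoˡ-≤ 1ℚ (p≤⌈p⌉ p)))))

ceiling-unique : ∀ p c → ℤ→ℚ c < p + 1ℚ → p ≤ ℤ→ℚ c → ceiling p ≡ c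
ceiling-unique p c c<p+1 p≤c = ℤP.≤-antisym (ceiling-least p c p≤c) (ceiling-greatest p c c<p+1)

ceiling-mono-≤ : ∀ {p q} → p ≤ q → ceiling p ℤ.≤ ceiling q
ceiling-mono-≤ {p} {q} p≤q = ceiling-least p (ceiling q) (ℚP.≤-trans p≤q (p≤⌈p⌉ q))

⌈p-c⌉≡⌈p⌉-c : ∀ p c → ceiling (p - ℤ→ℚ c) ≡ ceiling p ℤ.- c
⌈p-c⌉≡⌈p⌉-c p c = ceiling-unique (p - ℤ→ℚ c) (ceiling p ℤ.- c)
  (<-from-difference (trans (cong (λ x → p - ℤ→ℚ c + 1ℚ - x) (ℤ→ℚ-- (ceiling p) c))
                            (shift₁ p (ℤ→ℚ c) (ℤ→ℚ (ceiling p))))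
    (p<q⇒0<q-p (⌈p⌉<p+1 p)))
  (≤-from-difference (trans (cong (_- (p - ℤ→ℚ c)) (ℤ→ℚ-- (ceiling p) c))
                            (shift₂ p (ℤ→ℚ c) (ℤ→ℚ (ceiling p))))
    (p≤q⇒0≤q-p (p≤⌈p⌉ p)))
  where
  shift₁ : ∀ a b x → a - b + 1ℚ - (x - b) ≡ a + 1ℚ - x
  shift₁ = solve-∀ ℚ-ring
  shift₂ : ∀ a b x → x - b - (a - b) ≡ x - a
  shift₂ = solve-∀ ℚ-ring

-- Finite sums and counting

infix 3 _when_

_when_ : ∀ {a} {A : Set a} → ℚ → Dec A → ℚ
q when d = if does d then q else 0ℚ

when-yes : ∀ {a} {A : Set a} (d : Dec A) q → A → (q when d) ≡ q
when-yes (yes _) q _ = refl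
when-yes (no ¬a) q a = ⊥-elim (¬a a)

when-no : ∀ {a} {A : Set a} (d : Dec A) q → ¬ A → (q when d) ≡ 0ℚ
when-no (yes a) q ¬a = ⊥-elim (¬a a)
when-no (no _) q _ = refl

0<when⇒ : ∀ {a} {A : Set a} (d : Dec A) {q} → 0ℚ ℚ.< (q when d) → A
0<when⇒ (yes a) _ = a
0<when⇒ (no _) 0<0 = ⊥-elim (ℚP.<-irrefl refl 0<0)

0≤when : ∀ {a} {A : Set a} (d : Dec A) {q} → 0ℚ ≤ q → 0ℚ ≤ (q when d)
0≤when (yes _) 0≤q = 0≤q
0≤when (no _) _ = ℚP.≤-refl

when-≤ : ∀ {a} {A : Set a} (d : Dec A) {q} → 0ℚ ≤ q → (q when d) ≤ q
when-≤ (yes _) _ = ℚP.≤-refl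
when-≤ (no _) 0≤q = 0≤q

when-mono-≤ : ∀ {a} {A : Set a} (d : Dec A) {p q} → p ≤ q → (p when d) ≤ (q when d)
when-mono-≤ (yes _) p≤q = p≤q
when-mono-≤ (no _) _ = ℚP.≤-refl

when-distrib-− : ∀ {a} {A : Set a} (d : Dec A) p q → (p - q when d) ≡ (p when d) - (q when d)
when-distrib-− (yes _) p q = refl
when-distrib-− (no _) p q = refl

sumℚ-map-allFin : ∀ m (f : Fin m → ℚ) → sumℚ (map f (allFin m)) ≡ sum f
sumℚ-map-allFin m f = trans (cong sumℚ (ListP.map-tabulate id f)) (sumℚ-tabulate m f)
  where
  sumℚ-tabulate : ∀ m (f : Fin m → ℚ) → sumℚ (tabulate f) ≡ sum f
  sumℚ-tabulate zero f = refl
  sumℚ-tabulate (suc m) f = cong (f zero +_) (sumℚ-tabulate m (f ∘ suc))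

sumℚ-map-filter : ∀ {A : Set} {ℓ} {P : Pred A ℓ} (P? : Decidable P) (f : A → ℚ) xs →
  sumℚ (map f (filter P? xs)) ≡ sumℚ (map (λ x → (f x when P? x)) xs)
sumℚ-map-filter P? f [] = refl
sumℚ-map-filter P? f (x ∷ xs) with does (P? x)
... | true = cong (f x +_) (sumℚ-map-filter P? f xs)
... | false = trans (sumℚ-map-filter P? f xs) (sym (ℚP.+-identityˡ _))

sum-mono-≤ : ∀ {m} {f g : Fin m → ℚ} → (∀ i → f i ≤ g i) → sum f ≤ sum g
sum-mono-≤ {zero} f≤g = ℚP.≤-refl
sum-mono-≤ {suc m} f≤g = ℚP.+-mono-≤ (f≤g zero) (sum-mono-≤ (f≤g ∘ suc))

sum-distrib-− : ∀ {m} (f g : Fin m → ℚ) → sum (λ i → f i - g i) ≡ sum f - sum g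
sum-distrib-− {zero} f g = refl
sum-distrib-− {suc m} f g = trans (cong (f zero - g zero +_) (sum-distrib-− (f ∘ suc) (g ∘ suc)))
  (interchange (f zero) (g zero) (sum (f ∘ suc)) (sum (g ∘ suc)))
  where
  interchange : ∀ a b c d → a - b + (c - d) ≡ a + c - (b + d)
  interchange = solve-∀ ℚ-ring

sum-when-≟ : ∀ {m} (x : Fin m) (g : Fin m → ℚ) → sum (λ y → g y when y ≟ x) ≡ g x
sum-when-≟ {suc m} zero g = trans (cong (g zero +_) (sum-replicate-zero m)) (ℚP.+-identityʳ (g zero))
sum-when-≟ {suc m} (suc x) g = trans (ℚP.+-identityˡ _) (sum-when-≟ x (g ∘ suc))

module _ {m : ℕ} where
  open DecMembership (_≟_ {m}) using (_∈?_)

  sum-when-∈ : ∀ xs → AllPairs (λ a b → a ≢ b) xs → (g : Fin m → ℚ) →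
    sum (λ y → g y when y ∈? xs) ≡ sumℚ (map g xs)
  sum-when-∈ [] _ g = sum-replicate-zero m
  sum-when-∈ (x ∷ xs) (x∉xs ∷ distinct) g = begin
    sum (λ y → g y when y ∈? x ∷ xs)
      ≡⟨ sum-cong-≗ split ⟩
    sum (λ y → (g y when y ≟ x) + (g y when y ∈? xs))
      ≡⟨ ∑-distrib-+ (λ y → g y when y ≟ x) (λ y → g y when y ∈? xs) ⟩
    sum (λ y → g y when y ≟ x) + sum (λ y → g y when y ∈? xs)
      ≡⟨ cong₂ _+_ (sum-when-≟ x g) (sum-when-∈ xs distinct g) ⟩
    g x + sumℚ (map g xs) ∎
    where
    open ≡-Reasoning
    x∉ : x ∉ xs
    x∉ x∈xs = lookup x∉xs x∈xs refl
    split : ∀ y → (g y when y ∈? x ∷ xs) ≡ (g y when y ≟ x) + (g y when y ∈? xs)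
    split y with y ≟ x
    ... | yes refl = sym (trans (cong (g y +_) (when-no (y ∈? xs) (g y) x∉)) (ℚP.+-identityʳ (g y)))
    ... | no _ with y ∈? xs
    ...   | yes _ = sym (ℚP.+-identityˡ (g y))
    ...   | no _ = refl

  sumℚ-when-≟ : ∀ xs → AllPairs (λ a b → a ≢ b) xs → (g : Fin m → ℚ) → ∀ x →
    sumℚ (map (λ w → g w when x ≟ w) xs) ≡ (g x when x ∈? xs)
  sumℚ-when-≟ [] _ g x = refl
  sumℚ-when-≟ (w ∷ xs) (w∉xs ∷ distinct) g x with x ≟ w
  ... | yes refl = trans (cong (g x +_) (trans (sumℚ-when-≟ xs distinct g x) (when-no (x ∈? xs) (g x) x∉xs)))
                         (ℚP.+-identityʳ (g x))
    where
    x∉xs : x ∉ xs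
    x∉xs x∈xs = lookup w∉xs x∈xs refl
  ... | no _ = trans (ℚP.+-identityˡ _) (sumℚ-when-≟ xs distinct g x)

module _ {a} {A : Set a} where

  ∈-─ : ∀ {x z : A} {ys} → x ∈ ys → (z∈ys : z ∈ ys) → x ≢ z → x ∈ (ys ─ z∈ys)
  ∈-─ (here x≡y) (here z≡y) x≢z = ⊥-elim (x≢z (trans x≡y (sym z≡y)))
  ∈-─ (here x≡y) (there _) _ = here x≡y
  ∈-─ (there x∈ys) (here _) _ = x∈ys
  ∈-─ (there x∈ys) (there z∈ys) x≢z = there (∈-─ x∈ys z∈ys x≢z)

  distinct-⊆⇒length-≤ : ∀ {xs ys : List A} → AllPairs (λ x y → x ≢ y) xs → All (_∈ ys) xs →
    length xs ℕ.≤ length ys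
  distinct-⊆⇒length-≤ [] [] = z≤n
  distinct-⊆⇒length-≤ {ys = ys} (x≢xs ∷ distinct) (x∈ys ∷ xs⊆ys) =
    subst (_ ℕ.≤_) (sym (ListP.length-removeAt′ ys (index x∈ys)))
      (s≤s (distinct-⊆⇒length-≤ distinct (All.zipWith (λ (y≢x , y∈ys) → ∈-─ y∈ys x∈ys (≢-sym y≢x))
        (x≢xs , xs⊆ys))))

sumℤ-map-ones : ∀ {A : Set} (f : A → ℤ.ℤ) xs → All (λ x → f x ≡ ℤ.+ 1) xs →
  sumℤ (map f xs) ≡ ℤ.+ length xs
sumℤ-map-ones f [] [] = refl
sumℤ-map-ones f (x ∷ xs) (fx≡1 ∷ ones) rewrite fx≡1 | sumℤ-map-ones f xs ones = refl

-- Ancestors and walks in the tree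

module _ {n : ℕ} (I : Instance n) where
  open Instance I

  par<suc : ∀ i → toℕ (par i) ℕ.< toℕ (suc i)
  par<suc i = s≤s (par< i)

  ∈-up-self : ∀ k x → x ∈ up I k x
  ∈-up-self zero x = here refl
  ∈-up-self (suc k) zero = here refl
  ∈-up-self (suc k) (suc i) = here refl

  ∈-up⇒≤ : ∀ k x {y} → y ∈ up I k x → toℕ y ℕ.≤ toℕ x
  ∈-up⇒≤ zero x (here refl) = ℕP.≤-refl
  ∈-up⇒≤ (suc k) zero (here refl) = ℕP.≤-refl
  ∈-up⇒≤ (suc k) (suc i) (here refl) = ℕP.≤-refl
  ∈-up⇒≤ (suc k) (suc i) (there y∈up) = ℕP.≤-trans (∈-up⇒≤ k (par i) y∈up) (ℕP.<⇒≤ (par<suc i))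

  up-fuel : ∀ k k' x → toℕ x ℕ.≤ k → toℕ x ℕ.≤ k' → up I k x ≡ up I k' x
  up-fuel zero zero x _ _ = refl
  up-fuel zero (suc k') zero _ _ = refl
  up-fuel (suc k) zero zero _ _ = refl
  up-fuel (suc k) (suc k') zero _ _ = refl
  up-fuel (suc k) (suc k') (suc i) (s≤s i≤k) (s≤s i≤k') =
    cong (suc i ∷_) (up-fuel k k' (par i) (ℕP.≤-trans (par< i) i≤k) (ℕP.≤-trans (par< i) i≤k'))

  pathToRoot-suc : ∀ i → pathToRoot I (suc i) ≡ suc i ∷ pathToRoot I (par i)
  pathToRoot-suc i = unfold n (toℕ<n i)
    where
    unfold : ∀ k → toℕ i ℕ.< k → up I k (suc i) ≡ suc i ∷ up I n (par i)
    unfold (suc k) (s≤s i≤k) = cong (suc i ∷_)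
      (up-fuel k n (par i) (ℕP.≤-trans (par< i) i≤k) (ℕP.≤-trans (par< i) (ℕP.<⇒≤ (toℕ<n i))))

  InT-refl : ∀ x → InT I x x
  InT-refl = ∈-up-self n

  InT⇒≤ : ∀ {x y} → InT I x y → toℕ x ℕ.≤ toℕ y
  InT⇒≤ = ∈-up⇒≤ n _

  InT-trans : ∀ {e x y} → InT I e x → InT I x y → InT I e y
  InT-trans {e} {x} {y} e∈path x∈path = go n y (ℕP.≤-pred (toℕ<n y)) x∈path e∈path
    where
    go : ∀ k y → toℕ y ℕ.≤ k → x ∈ up I k y → e ∈ up I k x → e ∈ up I k y
    go zero y _ (here refl) e∈up = e∈up
    go (suc k) zero _ (here refl) e∈up = e∈up
    go (suc k) (suc i) _ (here refl) e∈up = e∈up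
    go (suc k) (suc i) (s≤s i≤k) (there x∈up) e∈up =
      there (go k (par i) pi≤k x∈up (subst (e ∈_) (up-fuel (suc k) k x (ℕP.m≤n⇒m≤1+n x≤k) x≤k) e∈up))
      where
      pi≤k : toℕ (par i) ℕ.≤ k
      pi≤k = ℕP.≤-trans (par< i) i≤k
      x≤k : toℕ x ℕ.≤ k
      x≤k = ℕP.≤-trans (∈-up⇒≤ k (par i) x∈up) pi≤k

  child-InT : ∀ {w x} → IsChild I w x → InT I x w
  child-InT (j , refl , refl) rewrite pathToRoot-suc j = there (InT-refl (par j))

  child-¬InT : ∀ {w x} → IsChild I w x → ¬ InT I w x
  child-¬InT (j , refl , refl) w∈path = ℕP.<⇒≱ (par<suc j) (InT⇒≤ w∈path)

  InT-below-child : ∀ {x y} → InT I x y → y ≢ x → ∃ λ w → IsChild I w x × InT I w y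
  InT-below-child = go n _
    where
    go : ∀ k y {x} → x ∈ up I k y → y ≢ x → ∃ λ w → IsChild I w x × w ∈ up I k y
    go zero y (here refl) y≢x = ⊥-elim (y≢x refl)
    go (suc k) zero (here refl) y≢x = ⊥-elim (y≢x refl)
    go (suc k) (suc i) (here refl) y≢x = ⊥-elim (y≢x refl)
    go (suc k) (suc i) {x} (there x∈up) _ with par i ≟ x
    ... | yes refl = suc i , (i , refl , refl) , here refl
    ... | no pi≢x with go k (par i) x∈up pi≢x
    ...   | w , w-child , w∈up = w , w-child , there w∈up

  InT-leaf : ∀ {w y} → IsLeaf I w → InT I w y → y ≡ w
  InT-leaf {w} {y} leaf w∈path with y ≟ w
  ... | yes y≡w = y≡w
  ... | no y≢w with InT-below-child w∈path y≢w
  ...   | c , c-child , _ = ⊥-elim (leaf c c-child)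

  pathToRoot-distinct : ∀ x → AllPairs (λ a b → a ≢ b) (pathToRoot I x)
  pathToRoot-distinct = go n
    where
    go : ∀ k x → AllPairs (λ a b → a ≢ b) (up I k x)
    go zero x = [] ∷ []
    go (suc k) zero = [] ∷ []
    go (suc k) (suc i) = All.tabulate above ∷ go k (par i)
      where
      above : ∀ {b} → b ∈ up I k (par i) → suc i ≢ b
      above b∈up refl = ℕP.<⇒≱ (par<suc i) (∈-up⇒≤ k (par i) b∈up)

  edgeLen-to-parent : ∀ j → edgeLen I (suc j) (par j) ≡ len j
  edgeLen-to-parent j with par j ≟ par j
  ... | yes _ = refl
  ... | no pj≢pj = ⊥-elim (pj≢pj refl)

  edgeLen-to-child : ∀ j → edgeLen I (par j) (suc j) ≡ len j
  edgeLen-to-child j = go (par j) refl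
    where
    go : ∀ a → par j ≡ a → edgeLen I a (suc j) ≡ len j
    go zero pj≡0 with par j ≟ zero
    ... | yes _ = refl
    ... | no pj≢0 = ⊥-elim (pj≢0 pj≡0)
    go (suc k) pj≡k with par k ≟ suc j
    ... | yes pk≡j = ⊥-elim (ℕP.<-asym (subst (λ a → toℕ a ℕ.< toℕ (suc k)) pk≡j (par<suc k))
                                       (subst (λ a → toℕ a ℕ.< toℕ (suc j)) pj≡k (par<suc j)))
    ... | no _ with par j ≟ suc k
    ...   | yes _ = refl
    ...   | no pj≢k = ⊥-elim (pj≢k pj≡k)

  stemLen≥0 : ∀ x → 0ℚ ≤ stemLen I x
  stemLen≥0 zero = ℚP.≤-refl
  stemLen≥0 (suc j) = len≥0 j

module _ {n : ℕ} (I : Instance n) where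
  open Instance I

  edgeLen-child : ∀ {w x} → IsChild I w x → edgeLen I x w ≡ stemLen I w
  edgeLen-child (j , refl , refl) = edgeLen-to-child I j

  edgeLen-parent : ∀ {w x} → IsChild I w x → edgeLen I w x ≡ stemLen I w
  edgeLen-parent (j , refl , refl) = edgeLen-to-parent I j

  sumStemLen : List (V I) → ℚ
  sumStemLen xs = sumℚ (map (stemLen I) xs)

  walkLen-∷-up : ∀ y k x → walkLen I (y ∷ up I k x) ≡ edgeLen I y x + walkLen I (up I k x)
  walkLen-∷-up y zero x = refl
  walkLen-∷-up y (suc k) zero = refl
  walkLen-∷-up y (suc k) (suc i) = refl

  linked-∷-up : ∀ {y} k x → Adj I y x → Linked (Adj I) (up I k x) → Linked (Adj I) (y ∷ up I k x)
  linked-∷-up zero x y~x linked = y~x ∷ linked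
  linked-∷-up (suc k) zero y~x linked = y~x ∷ linked
  linked-∷-up (suc k) (suc i) y~x linked = y~x ∷ linked

  walkLen-up : ∀ k x → toℕ x ℕ.≤ k → walkLen I (up I k x) ≡ sumStemLen (up I k x)
  walkLen-up zero zero _ = refl
  walkLen-up (suc k) zero _ = refl
  walkLen-up (suc k) (suc i) (s≤s i≤k) =
    trans (walkLen-∷-up (suc i) k (par i))
      (cong₂ _+_ (edgeLen-to-parent I i) (walkLen-up k (par i) (ℕP.≤-trans (par< i) i≤k)))

  last-∷-up : ∀ y k x → last (y ∷ up I k x) ≡ last (up I k x)
  last-∷-up y zero x = refl
  last-∷-up y (suc k) zero = refl
  last-∷-up y (suc k) (suc i) = refl

  up-last : ∀ k x → toℕ x ℕ.≤ k → last (up I k x) ≡ just zero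
  up-last zero zero _ = refl
  up-last (suc k) zero _ = refl
  up-last (suc k) (suc i) (s≤s i≤k) =
    trans (last-∷-up (suc i) k (par i)) (up-last k (par i) (ℕP.≤-trans (par< i) i≤k))

  up-linked : ∀ k x → Linked (Adj I) (up I k x)
  up-linked zero x = [-]
  up-linked (suc k) zero = [-]
  up-linked (suc k) (suc i) = linked-∷-up k (par i) (inj₁ (i , refl , refl)) (up-linked k (par i))

  -- The walk from the root down to x, followed by rest.
  descent : ℕ → V I → List (V I) → List (V I)
  descent zero x rest = x ∷ rest
  descent (suc k) zero rest = zero ∷ rest
  descent (suc k) (suc i) rest = descent k (par i) (suc i ∷ rest)

  descent-head : ∀ k x rest → toℕ x ℕ.≤ k → head (descent k x rest) ≡ just zero
  descent-head zero zero rest _ = refl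
  descent-head (suc k) zero rest _ = refl
  descent-head (suc k) (suc i) rest (s≤s i≤k) = descent-head k (par i) (suc i ∷ rest) (ℕP.≤-trans (par< i) i≤k)

  descent-last : ∀ k x rest → last (descent k x rest) ≡ last (x ∷ rest)
  descent-last zero x rest = refl
  descent-last (suc k) zero rest = refl
  descent-last (suc k) (suc i) rest = descent-last k (par i) (suc i ∷ rest)

  descent-linked : ∀ k x rest → Linked (Adj I) (x ∷ rest) → Linked (Adj I) (descent k x rest)
  descent-linked zero x rest linked = linked
  descent-linked (suc k) zero rest linked = linked
  descent-linked (suc k) (suc i) rest linked =
    descent-linked k (par i) (suc i ∷ rest) (inj₂ (i , refl , refl) ∷ linked)

  descent-walkLen : ∀ k x rest → toℕ x ℕ.≤ k →
    walkLen I (descent k x rest) ≡ sumStemLen (up I k x) + walkLen I (x ∷ rest)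
  descent-walkLen zero zero rest _ = sym (ℚP.+-identityˡ _)
  descent-walkLen (suc k) zero rest _ = sym (ℚP.+-identityˡ _)
  descent-walkLen (suc k) (suc i) rest (s≤s i≤k) = begin
    walkLen I (descent k (par i) (suc i ∷ rest))
      ≡⟨ descent-walkLen k (par i) (suc i ∷ rest) (ℕP.≤-trans (par< i) i≤k) ⟩
    sumStemLen (up I k (par i)) + (edgeLen I (par i) (suc i) + walkLen I (suc i ∷ rest))
      ≡⟨ cong (λ l → sumStemLen (up I k (par i)) + (l + walkLen I (suc i ∷ rest))) (edgeLen-to-child I i) ⟩
    sumStemLen (up I k (par i)) + (len i + walkLen I (suc i ∷ rest))
      ≡⟨ reassoc (sumStemLen (up I k (par i))) (len i) (walkLen I (suc i ∷ rest)) ⟩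
    (len i + sumStemLen (up I k (par i))) + walkLen I (suc i ∷ rest) ∎
    where
    open ≡-Reasoning
    reassoc : ∀ a b c → a + (b + c) ≡ (b + a) + c
    reassoc = solve-∀ ℚ-ring

  descent-⊇ : ∀ k x rest {y} → y ∈ rest → y ∈ descent k x rest
  descent-⊇ zero x rest y∈rest = there y∈rest
  descent-⊇ (suc k) zero rest y∈rest = there y∈rest
  descent-⊇ (suc k) (suc i) rest y∈rest = descent-⊇ k (par i) (suc i ∷ rest) (there y∈rest)

  module StarTour (i : Fin n) where
    v : V I
    v = suc i

    excursions : List (V I) → List (V I)
    excursions [] = pathToRoot I (par i)
    excursions (w ∷ ws) = w ∷ v ∷ excursions ws

    starWalk : List (V I) → List (V I)
    starWalk ws = descent n v (excursions ws)

    v≤n : toℕ v ℕ.≤ n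
    v≤n = toℕ<n i

    excursions-linked : ∀ ws → All (λ w → IsChild I w v) ws → Linked (Adj I) (v ∷ excursions ws)
    excursions-linked [] [] = subst (Linked (Adj I)) (pathToRoot-suc I i) (up-linked n v)
    excursions-linked (w ∷ ws) (w-child ∷ ws-children) =
      inj₂ w-child ∷ inj₁ w-child ∷ excursions-linked ws ws-children

    excursions-last : ∀ ws → last (v ∷ excursions ws) ≡ just zero
    excursions-last [] = trans (cong last (sym (pathToRoot-suc I i))) (up-last n v v≤n)
    excursions-last (w ∷ ws) = excursions-last ws

    excursions-walkLen : ∀ ws → All (λ w → IsChild I w v) ws →
      walkLen I (v ∷ excursions ws) ≡ 2ℚ * sumStemLen ws + pathLen I v
    excursions-walkLen [] [] = begin
      walkLen I (v ∷ pathToRoot I (par i)) ≡⟨ cong (walkLen I) (sym (pathToRoot-suc I i)) ⟩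
      walkLen I (pathToRoot I v)           ≡⟨ walkLen-up n v v≤n ⟩
      pathLen I v                          ≡⟨ sym (ℚP.+-identityˡ (pathLen I v)) ⟩
      2ℚ * 0ℚ + pathLen I v                ∎
      where open ≡-Reasoning
    excursions-walkLen (w ∷ ws) (w-child ∷ ws-children) = begin
      edgeLen I v w + (edgeLen I w v + walkLen I (v ∷ excursions ws))
        ≡⟨ cong₂ (λ a b → a + (b + walkLen I (v ∷ excursions ws)))
                 (edgeLen-child w-child) (edgeLen-parent w-child) ⟩
      stemLen I w + (stemLen I w + walkLen I (v ∷ excursions ws))
        ≡⟨ cong (λ l → stemLen I w + (stemLen I w + l)) (excursions-walkLen ws ws-children) ⟩
      stemLen I w + (stemLen I w + (2ℚ * sumStemLen ws + pathLen I v))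
        ≡⟨ double (stemLen I w) (sumStemLen ws) (pathLen I v) ⟩
      2ℚ * (stemLen I w + sumStemLen ws) + pathLen I v ∎
      where
      open ≡-Reasoning
      double : ∀ l s p → l + (l + (2ℚ * s + p)) ≡ 2ℚ * (l + s) + p
      double = solve-∀ ℚ-ring

    starWalk-walkLen : ∀ ws → All (λ w → IsChild I w v) ws →
      walkLen I (starWalk ws) ≡ 2ℚ * (pathLen I v + sumStemLen ws)
    starWalk-walkLen ws ws-children = begin
      walkLen I (descent n v (excursions ws))          ≡⟨ descent-walkLen n v (excursions ws) v≤n ⟩
      pathLen I v + walkLen I (v ∷ excursions ws)
        ≡⟨ cong (pathLen I v +_) (excursions-walkLen ws ws-children) ⟩
      pathLen I v + (2ℚ * sumStemLen ws + pathLen I v) ≡⟨ double (pathLen I v) (sumStemLen ws) ⟩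
      2ℚ * (pathLen I v + sumStemLen ws)               ∎
      where
      open ≡-Reasoning
      double : ∀ p s → p + (2ℚ * s + p) ≡ 2ℚ * (p + s)
      double = solve-∀ ℚ-ring

    starTour : (ws : List (V I)) → All (λ w → IsChild I w v) ws →
      (c : V I → ℚ) → (∀ x → 0ℚ ≤ c x) → sumℚ (map c (allFin (suc n))) ≤ 1ℚ →
      (∀ x → 0ℚ < c x → x ∈ ws) → Tour I
    starTour ws ws-children c c≥0 c≤1 c-visits = record
      { walk = starWalk ws
      ; startsAtr = descent-head n v (excursions ws) v≤n
      ; endsAtr = trans (descent-last n v (excursions ws)) (excursions-last ws)
      ; isWalk = descent-linked n v (excursions ws) (excursions-linked ws ws-children)
      ; cover = c
      ; cover≥0 = c≥0
      ; cover≤1 = c≤1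
      ; visited = λ x 0<cx → descent-⊇ n v (excursions ws) (excursions-⊇ ws (c-visits x 0<cx))
      }
      where
      excursions-⊇ : ∀ ws {x} → x ∈ ws → x ∈ excursions ws
      excursions-⊇ (w ∷ ws) (here x≡w) = here x≡w
      excursions-⊇ (w ∷ ws) (there x∈ws) = there (there (excursions-⊇ ws x∈ws))

-- Traffic and the lower bound

module _ {n : ℕ} (I : Instance n) where
  open Instance I
  open DecMembership (_≟_ {suc n}) using (_∈?_)

  inT? : ∀ x y → Dec (InT I x y)
  inT? x y = any? (x ≟_) (pathToRoot I y)

  subDem-sum : ∀ d x → subDem I d x ≡ sum (λ y → d y when inT? x y)
  subDem-sum d x =
    trans (sumℚ-map-filter (inT? x) d (allFin (suc n))) (sumℚ-map-allFin (suc n) (λ y → d y when inT? x y))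

  subDem-mono : ∀ {d d'} → (∀ y → d' y ≤ d y) → ∀ x → subDem I d' x ≤ subDem I d x
  subDem-mono {d} {d'} d'≤d x = subst₂ _≤_ (sym (subDem-sum d' x)) (sym (subDem-sum d x))
    (sum-mono-≤ (λ y → when-mono-≤ (inT? x y) (d'≤d y)))

  traffic-mono : ∀ {d d'} → (∀ y → d' y ≤ d y) → ∀ x → traffic I d' x ℤ.≤ traffic I d x
  traffic-mono d'≤d zero = ℤP.≤-refl
  traffic-mono d'≤d (suc j) = ceiling-mono-≤ (subDem-mono d'≤d (suc j))

  subDem-remove : ∀ d C x → (∀ y → ¬ InT I x y → C y ≡ 0ℚ) →
    subDem I (λ y → d y - C y) x ≡ subDem I d x - sum C
  subDem-remove d C x C-inside = begin
    subDem I (λ y → d y - C y) x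
      ≡⟨ subDem-sum _ x ⟩
    sum (λ y → d y - C y when inT? x y)
      ≡⟨ sum-cong-≗ (λ y → when-distrib-− (inT? x y) (d y) (C y)) ⟩
    sum (λ y → (d y when inT? x y) - (C y when inT? x y))
      ≡⟨ sum-distrib-− (λ y → d y when inT? x y) (λ y → C y when inT? x y) ⟩
    sum (λ y → d y when inT? x y) - sum (λ y → C y when inT? x y)
      ≡⟨ cong₂ _-_ (sym (subDem-sum d x)) (sum-cong-≗ C-restricted) ⟩
    subDem I d x - sum C ∎
    where
    open ≡-Reasoning
    C-restricted : ∀ y → (C y when inT? x y) ≡ C y
    C-restricted y with inT? x y
    ... | yes _ = refl
    ... | no y∉T = sym (C-inside y y∉T)

  subDem-leaf : ∀ d {w} → IsLeaf I w → subDem I d w ≡ d w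
  subDem-leaf d {w} leaf = trans (subDem-sum d w) (trans (sum-cong-≗ only-w) (sum-when-≟ w d))
    where
    only-w : ∀ y → (d y when inT? w y) ≡ (d y when y ≟ w)
    only-w y with inT? w y | y ≟ w
    ... | yes _ | yes _ = refl
    ... | yes w∈path | no y≢w = ⊥-elim (y≢w (InT-leaf I leaf w∈path))
    ... | no w∉path | yes refl = ⊥-elim (w∉path (InT-refl I y))
    ... | no _ | no _ = refl

  trafficDrop : (V I → ℚ) → (V I → ℚ) → Fin n → ℚ
  trafficDrop d C j = ℤ→ℚ (traffic I d (suc j)) - ℤ→ℚ (traffic I (λ y → d y - C y) (suc j))

  LB-difference : ∀ d C → LB I d - LB I (λ y → d y - C y) ≡ sum (λ j → 2ℚ * len j * trafficDrop d C j)
  LB-difference d C = begin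
    LB I d - LB I d′                           ≡⟨ cong₂ _-_ (sumℚ-map-allFin n (cost d)) (sumℚ-map-allFin n (cost d′)) ⟩
    sum (cost d) - sum (cost d′)               ≡⟨ sym (sum-distrib-− (cost d) (cost d′)) ⟩
    sum (λ j → cost d j - cost d′ j)           ≡⟨ sum-cong-≗ (λ j → factor (2ℚ * len j) _ _) ⟩
    sum (λ j → 2ℚ * len j * trafficDrop d C j) ∎
    where
    open ≡-Reasoning
    d′ : V I → ℚ
    d′ y = d y - C y
    cost : (V I → ℚ) → Fin n → ℚ
    cost d j = 2ℚ * len j * ℤ→ℚ (traffic I d (suc j))
    factor : ∀ a b c → a * b - a * c ≡ a * (b - c)
    factor = solve-∀ ℚ-ring

  trafficDrop≥0 : ∀ d C → (∀ y → 0ℚ ≤ C y) → ∀ j → 0ℚ ≤ trafficDrop d C j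
  trafficDrop≥0 d C C≥0 j = p≤q⇒0≤q-p (ℤ→ℚ-mono-≤ (traffic-mono d-C≤d (suc j)))
    where
    d-C≤d : ∀ y → d y - C y ≤ d y
    d-C≤d y = ≤-from-difference (cancel (d y) (C y)) (C≥0 y)
      where
      cancel : ∀ a c → a - (a - c) ≡ c
      cancel = solve-∀ ℚ-ring

  trafficDrop-leaf : ∀ d C {j} → IsLeaf I (suc j) → traffic I d (suc j) ≡ ℤ.+ 1 → C (suc j) ≡ d (suc j) →
    trafficDrop d C j ≡ 1ℚ
  trafficDrop-leaf d C {j} leaf traffic≡1 C≡d = cong₂ (λ a b → ℤ→ℚ a - ℤ→ℚ b) traffic≡1
    (cong ceiling (trans (subDem-leaf (λ y → d y - C y) leaf)
      (trans (cong (λ c → d (suc j) - c) C≡d) (ℚP.+-inverseʳ (d (suc j))))))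

  sum-stemLen-when-∈ : ∀ xs → AllPairs (λ a b → a ≢ b) xs →
    sum (λ j → len j when suc j ∈? xs) ≡ sumStemLen I xs
  sum-stemLen-when-∈ xs distinct = trans (sym root-term) (sum-when-∈ xs distinct (stemLen I))
    where
    root-term : (0ℚ when zero ∈? xs) + sum (λ j → len j when suc j ∈? xs) ≡
                sum (λ j → len j when suc j ∈? xs)
    root-term with zero ∈? xs
    ... | yes _ = ℚP.+-identityˡ _
    ... | no _ = ℚP.+-identityˡ _

  trafficDrop-inside : ∀ d C j k → (∀ y → ¬ InT I (suc j) y → C y ≡ 0ℚ) → ℤ→ℚ (ℤ.+ k) ≤ sum C →
    ℤ→ℚ (ℤ.+ k) ≤ trafficDrop d C j
  trafficDrop-inside d C j k C-inside k≤C =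
    ≤-from-difference (rearrange (ℤ→ℚ (traffic I d (suc j))) (ℤ→ℚ (traffic I d′ (suc j))) κ)
      (p≤q⇒0≤q-p (subst₂ _≤_ (cong ℤ→ℚ (sym (cong ceiling (subDem-remove d C (suc j) C-inside))))
                              (ℤ→ℚ-- (traffic I d (suc j)) (ℤ.+ k))
                              (ℤ→ℚ-mono-≤ ceiling-step)))
    where
    d′ : V I → ℚ
    d′ y = d y - C y
    κ : ℚ
    κ = ℤ→ℚ (ℤ.+ k)
    D : ℚ
    D = subDem I d (suc j)
    ceiling-step : ceiling (D - sum C) ℤ.≤ ceiling D ℤ.- ℤ.+ k
    ceiling-step = subst (ceiling (D - sum C) ℤ.≤_) (⌈p-c⌉≡⌈p⌉-c D (ℤ.+ k))
                     (ceiling-mono-≤ (ℚP.+-monoʳ-≤ D (ℚP.neg-antimono-≤ k≤C)))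
    rearrange : ∀ a b c → a - b - c ≡ a - c - b
    rearrange = solve-∀ ℚ-ring

  -- Removing C lowers the traffic of every edge of P[v,r] by at least k and that of every edge into a leaf
  -- of F by one, and it raises no traffic.
  LB-reduction : ∀ v C → (∀ x → 0ℚ ≤ C x) → (∀ x → ¬ InT I v x → C x ≡ 0ℚ) →
    ∀ k → ℤ→ℚ (ℤ.+ k) ≤ sum C →
    ∀ F → AllPairs (λ a b → a ≢ b) F →
    All (λ w → IsChild I w v × IsLeaf I w × traffic I dem w ≡ ℤ.+ 1 × C w ≡ dem w) F →
    2ℚ * (ℤ→ℚ (ℤ.+ k) * pathLen I v + sumStemLen I F) ≤ LB I dem - LB I (λ x → dem x - C x)
  LB-reduction v C C≥0 C-inside k k≤C F F-distinct F-leaves =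
    subst₂ _≤_ bound-sum (sym (LB-difference dem C)) (sum-mono-≤ bound≤cost)
    where
    κ : ℚ
    κ = ℤ→ℚ (ℤ.+ k)
    onPath : Fin n → ℚ
    onPath j = len j when suc j ∈? pathToRoot I v
    inF : Fin n → ℚ
    inF j = len j when suc j ∈? F

    scale : ∀ j {a b} → a ≤ b → 2ℚ * len j * a ≤ 2ℚ * len j * b
    scale j = ℚP.*-monoˡ-≤-nonNeg (2ℚ * len j) {{ℚ.nonNegative (nonNeg*nonNeg 0≤2ℚ (len≥0 j))}}

    bound≤cost : ∀ j → 2ℚ * (κ * onPath j + inF j) ≤ 2ℚ * len j * trafficDrop dem C j
    bound≤cost j with suc j ∈? pathToRoot I v | suc j ∈? F
    ... | yes j-above-v | yes j∈F with lookup F-leaves j∈F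
    ...   | j-child , _ = ⊥-elim (child-¬InT I j-child j-above-v)
    bound≤cost j | yes j-above-v | no _ =
      subst (_≤ _) (path-edge 2ℚ (len j) κ) (scale j (trafficDrop-inside dem C j k C-below-j k≤C))
      where
      C-below-j : ∀ y → ¬ InT I (suc j) y → C y ≡ 0ℚ
      C-below-j y y∉T = C-inside y (λ y∈T → y∉T (InT-trans I j-above-v y∈T))
      path-edge : ∀ t l c → t * l * c ≡ t * (c * l + 0ℚ)
      path-edge = solve-∀ ℚ-ring
    bound≤cost j | no _ | yes j∈F with lookup F-leaves j∈F
    ... | _ , leaf , traffic≡1 , C≡dem =
      subst (_≤ _) (leaf-edge 2ℚ (len j) κ)
        (scale j (ℚP.≤-reflexive (sym (trafficDrop-leaf dem C leaf traffic≡1 C≡dem))))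
      where
      leaf-edge : ∀ t l c → t * l * 1ℚ ≡ t * (c * 0ℚ + l)
      leaf-edge = solve-∀ ℚ-ring
    bound≤cost j | no _ | no _ =
      subst (_≤ _) (other-edge 2ℚ (len j) κ) (scale j (trafficDrop≥0 dem C C≥0 j))
      where
      other-edge : ∀ t l c → t * l * 0ℚ ≡ t * (c * 0ℚ + 0ℚ)
      other-edge = solve-∀ ℚ-ring

    bound-sum : sum (λ j → 2ℚ * (κ * onPath j + inF j)) ≡ 2ℚ * (κ * pathLen I v + sumStemLen I F)
    bound-sum = begin
      sum (λ j → 2ℚ * (κ * onPath j + inF j))
        ≡⟨ sym (*-distribˡ-sum 2ℚ (λ j → κ * onPath j + inF j)) ⟩
      2ℚ * sum (λ j → κ * onPath j + inF j)
        ≡⟨ cong (2ℚ *_) (∑-distrib-+ (λ j → κ * onPath j) inF) ⟩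
      2ℚ * (sum (λ j → κ * onPath j) + sum inF)
        ≡⟨ cong (λ s → 2ℚ * (s + sum inF)) (sym (*-distribˡ-sum κ onPath)) ⟩
      2ℚ * (κ * sum onPath + sum inF)
        ≡⟨ cong₂ (λ p f → 2ℚ * (κ * p + f)) (sum-stemLen-when-∈ (pathToRoot I v) (pathToRoot-distinct I v))
                                            (sum-stemLen-when-∈ F F-distinct) ⟩
      2ℚ * (κ * pathLen I v + sumStemLen I F)       ∎
      where open ≡-Reasoning

module _ {n : ℕ} (I : Instance n) where
  open Instance I
  open DecMembership (_≟_ {suc n}) using (_∈?_)

  child∈childIdx : ∀ {w x} → IsChild I w x → w ∈ map suc (childIdx I x)
  child∈childIdx (j , refl , pj≡x) = ∈-map⁺ suc (∈-filter⁺ (λ j → par j ≟ _) (∈-allFin j) pj≡x)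

  length≤numChildren : ∀ {x ws} → AllPairs (λ a b → a ≢ b) ws → All (λ w → IsChild I w x) ws →
    length ws ℕ.≤ numChildren I x
  length≤numChildren {x} {ws} distinct children = subst (length ws ℕ.≤_) (ListP.length-map suc (childIdx I x))
    (distinct-⊆⇒length-≤ distinct (All.map child∈childIdx children))

  subDem-leaf-children : ∀ d {x} ws → AllPairs (λ a b → a ≢ b) ws → d x ≡ 0ℚ →
    All (λ w → IsChild I w x × IsLeaf I w) ws → (∀ w → IsChild I w x → w ∈ ws) →
    subDem I d x ≡ sumℚ (map d ws)
  subDem-leaf-children d {x} ws distinct dx≡0 leaf-children all-children =
    trans (subDem-sum I d x) (trans (sum-cong-≗ below-x) (sum-when-∈ ws distinct d))
    where
    below-x : ∀ y → (d y when inT? I x y) ≡ (d y when y ∈? ws)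
    below-x y with inT? I x y | y ∈? ws
    ... | yes _ | yes _ = refl
    ... | no y∉T | yes y∈ws = ⊥-elim (y∉T (child-InT I (proj₁ (lookup leaf-children y∈ws))))
    ... | no _ | no _ = refl
    ... | yes y∈T | no y∉ws with y ≟ x
    ...   | yes refl = dx≡0
    ...   | no y≢x with InT-below-child I y∈T y≢x
    ...     | c , c-child , c-above-y with all-children c c-child
    ...       | c∈ws =
      ⊥-elim (y∉ws (subst (_∈ ws) (sym (InT-leaf I (proj₂ (lookup leaf-children c∈ws)) c-above-y)) c∈ws))

-- Tour sets

-- The shapes of these inequalities, with their trailing 0ℚ terms, are those in which the tour lengths and
-- the bound of LB-reduction unfold.
leaf-tours-within-4/3 : ∀ Q la lb lc R → 2ℚ * (2ℚ * Q + (la + (lb + (lc + 0ℚ)))) ≤ R → Q ≤ la + lb + lc →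
  2ℚ * (Q + (la + 0ℚ)) + (2ℚ * (Q + (lb + 0ℚ)) + (2ℚ * (Q + (lc + 0ℚ)) + 0ℚ)) ≤ (ℤ.+ 4 / 3) * R
leaf-tours-within-4/3 Q la lb lc R reduction Q≤stems =
  ≤-from-difference (slack Q la lb lc R)
    (ℚP.+-mono-≤ (nonNeg*nonNeg {ℤ.+ 4 / 3} (ℚP.≤ᵇ⇒≤ _) (p≤q⇒0≤q-p reduction))
                 (nonNeg*nonNeg {ℤ.+ 2 / 3} (ℚP.≤ᵇ⇒≤ _) (p≤q⇒0≤q-p Q≤stems)))
  where
  slack : ∀ Q la lb lc R →
    (ℤ.+ 4 / 3) * R - (2ℚ * (Q + (la + 0ℚ)) + (2ℚ * (Q + (lb + 0ℚ)) + (2ℚ * (Q + (lc + 0ℚ)) + 0ℚ))) ≡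
    (ℤ.+ 4 / 3) * (R - 2ℚ * (2ℚ * Q + (la + (lb + (lc + 0ℚ))))) + (ℤ.+ 2 / 3) * (la + lb + lc - Q)
  slack = solve-∀ ℚ-ring

pair-tour-within-4/3 : ∀ Q lo lm R → 2ℚ * (1ℚ * Q + (lo + 0ℚ)) ≤ R → (ℤ.+ 3 / 1) * lm ≤ Q → 0ℚ ≤ lo →
  2ℚ * (Q + (lo + (lm + 0ℚ))) + 0ℚ ≤ (ℤ.+ 4 / 3) * R
pair-tour-within-4/3 Q lo lm R reduction 3lm≤Q 0≤lo =
  ≤-from-difference (slack Q lo lm R)
    (ℚP.+-mono-≤ (ℚP.+-mono-≤ (nonNeg*nonNeg {ℤ.+ 4 / 3} (ℚP.≤ᵇ⇒≤ _) (p≤q⇒0≤q-p reduction))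
                              (nonNeg*nonNeg {ℤ.+ 2 / 3} (ℚP.≤ᵇ⇒≤ _) (p≤q⇒0≤q-p 3lm≤Q)))
                 (nonNeg*nonNeg {ℤ.+ 2 / 3} (ℚP.≤ᵇ⇒≤ _) 0≤lo))
  where
  slack : ∀ Q lo lm R →
    (ℤ.+ 4 / 3) * R - (2ℚ * (Q + (lo + (lm + 0ℚ))) + 0ℚ) ≡
    (ℤ.+ 4 / 3) * (R - 2ℚ * (1ℚ * Q + (lo + 0ℚ))) + (ℤ.+ 2 / 3) * (Q - (ℤ.+ 3 / 1) * lm) + (ℤ.+ 2 / 3) * lo
  slack = solve-∀ ℚ-ring

module _ {n : ℕ} (I : Instance n) (i : Fin n) where
  open Instance I
  open StarTour I i using (v; starTour; starWalk-walkLen)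
  open DecMembership (_≟_ {suc n}) using (_∈?_)

  record OneBranchLeaf (w : V I) : Set where
    field
      child : IsChild I w v
      leaf : IsLeaf I w
      traffic≡1 : traffic I dem w ≡ ℤ.+ 1
      dem>0 : 0ℚ < dem w
      dem<1 : dem w < 1ℚ

  open OneBranchLeaf public

  leafTour : ∀ w → OneBranchLeaf w → Tour I
  leafTour w w-leaf =
    starTour (w ∷ []) (child w-leaf ∷ []) (λ x → dem w when x ≟ w) (λ x → 0≤when (x ≟ w) (dem≥0 w))
      (subst (_≤ 1ℚ) (sym (trans (sumℚ-map-allFin (suc n) (λ x → dem w when x ≟ w)) (sum-when-≟ w (λ _ → dem w))))
        (ℚP.<⇒≤ (dem<1 w-leaf)))
      (λ x 0<cover → here (0<when⇒ (x ≟ w) 0<cover))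

  leafTours : ∀ F → All OneBranchLeaf F → List (Tour I)
  leafTours [] [] = []
  leafTours (w ∷ F) (w-leaf ∷ F-leaves) = leafTour w w-leaf ∷ leafTours F F-leaves

  totalCover-leafTours : ∀ F → AllPairs (λ a b → a ≢ b) F → (F-leaves : All OneBranchLeaf F) → ∀ x →
    totalCover I (leafTours F F-leaves) x ≡ (dem x when x ∈? F)
  totalCover-leafTours F F-distinct F-leaves x = trans (unfold F F-leaves) (sumℚ-when-≟ F F-distinct dem x)
    where
    unfold : ∀ F F-leaves → totalCover I (leafTours F F-leaves) x ≡ sumℚ (map (λ w → dem w when x ≟ w) F)
    unfold [] [] = refl
    unfold (w ∷ F) (_ ∷ F-leaves) = cong ((dem w when x ≟ w) +_) (unfold F F-leaves)

  totalLen-leafTours : ∀ F F-leaves →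
    totalLen I (leafTours F F-leaves) ≡ sumℚ (map (λ w → 2ℚ * (pathLen I v + (stemLen I w + 0ℚ))) F)
  totalLen-leafTours [] [] = refl
  totalLen-leafTours (w ∷ F) (w-leaf ∷ F-leaves) =
    cong₂ _+_ (starWalk-walkLen (w ∷ []) (child w-leaf ∷ [])) (totalLen-leafTours F F-leaves)

  leafTours-cover : ∀ F F-leaves {t} → t ∈ leafTours F F-leaves → ∀ x → 0ℚ < Tour.cover t x → x ∈ F
  leafTours-cover (w ∷ F) (_ ∷ _) (here refl) x 0<cover = here (0<when⇒ (x ≟ w) 0<cover)
  leafTours-cover (w ∷ F) (_ ∷ F-leaves) (there t∈ts) x 0<cover =
    there (leafTours-cover F F-leaves t∈ts x 0<cover)

  admits-by-leaf-tours : ∀ {a b c} → a ≢ b → a ≢ c → b ≢ c →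
    OneBranchLeaf a → OneBranchLeaf b → OneBranchLeaf c →
    2ℚ ≤ dem a + dem b + dem c → pathLen I v ≤ stemLen I a + stemLen I b + stemLen I c →
    Admits I v
  admits-by-leaf-tours {a} {b} {c} a≢b a≢c b≢c a-leaf b-leaf c-leaf 2≤demand Q≤stems =
    ts , (λ ()) , covers-inside , (λ x → subst (_≤ dem x) (sym (C≡ x)) (when-≤ (x ∈? F) (dem≥0 x))) ,
    (a , subst (0ℚ <_) (sym (C-full (here refl))) (dem>0 a-leaf)) ,
    subst (_≤ (ℤ.+ 4 / 3) * (LB I dem - LB I (λ x → dem x - C x))) (sym (totalLen-leafTours F F-leaves))
      (leaf-tours-within-4/3 (pathLen I v) (stemLen I a) (stemLen I b) (stemLen I c) _
        (LB-reduction I v C C≥0 C-outside 2 2≤C F F-distinct F-removed) Q≤stems)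
    where
    F : List (V I)
    F = a ∷ b ∷ c ∷ []
    F-distinct : AllPairs (λ x y → x ≢ y) F
    F-distinct = (a≢b ∷ a≢c ∷ []) ∷ (b≢c ∷ []) ∷ [] ∷ []
    F-leaves : All OneBranchLeaf F
    F-leaves = a-leaf ∷ b-leaf ∷ c-leaf ∷ []
    ts : List (Tour I)
    ts = leafTours F F-leaves
    C : V I → ℚ
    C = totalCover I ts
    C≡ : ∀ x → C x ≡ (dem x when x ∈? F)
    C≡ = totalCover-leafTours F F-distinct F-leaves
    C≥0 : ∀ x → 0ℚ ≤ C x
    C≥0 x = subst (0ℚ ≤_) (sym (C≡ x)) (0≤when (x ∈? F) (dem≥0 x))
    C-full : ∀ {x} → x ∈ F → C x ≡ dem x
    C-full {x} x∈F = trans (C≡ x) (when-yes (x ∈? F) (dem x) x∈F)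
    F-inside : ∀ {x} → x ∈ F → InT I v x
    F-inside x∈F = child-InT I (child (lookup F-leaves x∈F))
    C-outside : ∀ x → ¬ InT I v x → C x ≡ 0ℚ
    C-outside x x∉T = trans (C≡ x) (when-no (x ∈? F) (dem x) (λ x∈F → x∉T (F-inside x∈F)))
    covers-inside : ∀ t → t ∈ ts → ∀ x → 0ℚ < Tour.cover t x → InT I v x
    covers-inside t t∈ts x 0<cover = F-inside (leafTours-cover F F-leaves t∈ts x 0<cover)
    sum-of-three : ∀ x y z → x + y + z ≡ x + (y + (z + 0ℚ))
    sum-of-three = solve-∀ ℚ-ring
    2≤C : 2ℚ ≤ sum C
    2≤C = subst (2ℚ ≤_) (sym (trans (sum-cong-≗ C≡) (sum-when-∈ F F-distinct dem)))
            (subst (2ℚ ≤_) (sum-of-three (dem a) (dem b) (dem c)) 2≤demand)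
    F-removed : All (λ w → IsChild I w v × IsLeaf I w × traffic I dem w ≡ ℤ.+ 1 × C w ≡ dem w) F
    F-removed = All.tabulate (λ w∈F → removed (lookup F-leaves w∈F) (C-full w∈F))
      where
      removed : ∀ {w} → OneBranchLeaf w → C w ≡ dem w →
        IsChild I w v × IsLeaf I w × traffic I dem w ≡ ℤ.+ 1 × C w ≡ dem w
      removed w-leaf Cw≡ = child w-leaf , leaf w-leaf , traffic≡1 w-leaf , Cw≡

  pairCover : V I → V I → V I → ℚ
  pairCover o m x = (dem o when x ≟ o) + (1ℚ - dem o when x ≟ m)

  sum-pairCover : ∀ o m → sum (pairCover o m) ≡ 1ℚ
  sum-pairCover o m = trans (∑-distrib-+ (λ x → dem o when x ≟ o) (λ x → 1ℚ - dem o when x ≟ m))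
    (trans (cong₂ _+_ (sum-when-≟ o (λ _ → dem o)) (sum-when-≟ m (λ _ → 1ℚ - dem o))) (complement (dem o)))
    where
    complement : ∀ a → a + (1ℚ - a) ≡ 1ℚ
    complement = solve-∀ ℚ-ring

  pairCover-visits : ∀ o m x → 0ℚ < pairCover o m x → x ∈ o ∷ m ∷ []
  pairCover-visits o m x 0<cx with x ≟ o | x ≟ m
  ... | yes x≡o | _ = here x≡o
  ... | no _ | yes x≡m = there (here x≡m)
  ... | no _ | no _ = ⊥-elim (ℚP.<-irrefl refl 0<cx)

  pairTour : ∀ {o m} → OneBranchLeaf o → IsChild I m v → Tour I
  pairTour {o} {m} o-leaf m-child =
    starTour (o ∷ m ∷ []) (child o-leaf ∷ m-child ∷ []) (pairCover o m) c≥0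
      (ℚP.≤-reflexive (trans (sumℚ-map-allFin (suc n) (pairCover o m)) (sum-pairCover o m))) (pairCover-visits o m)
    where
    c≥0 : ∀ x → 0ℚ ≤ pairCover o m x
    c≥0 x = ℚP.+-mono-≤ (0≤when (x ≟ o) (dem≥0 o))
                        (0≤when (x ≟ m) (p≤q⇒0≤q-p (ℚP.<⇒≤ (dem<1 o-leaf))))

  admits-by-pair-tour : ∀ {o m} → o ≢ m → OneBranchLeaf o → IsChild I m v →
    1ℚ < dem o + dem m → (ℤ.+ 3 / 1) * stemLen I m ≤ pathLen I v → Admits I v
  admits-by-pair-tour {o} {m} o≢m o-leaf m-child 1<pair 3lm≤Q =
    ts , (λ ()) , covers-inside , C≤dem , (o , subst (0ℚ <_) (sym C-o) (dem>0 o-leaf)) ,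
    subst (_≤ (ℤ.+ 4 / 3) * (LB I dem - LB I (λ x → dem x - C x)))
      (sym (cong (_+ 0ℚ) (starWalk-walkLen (o ∷ m ∷ []) (o-child ∷ m-child ∷ []))))
      (pair-tour-within-4/3 (pathLen I v) (stemLen I o) (stemLen I m) _
        (LB-reduction I v C C≥0 C-outside 1 1≤C (o ∷ []) ([] ∷ []) (removed ∷ [])) 3lm≤Q (stemLen≥0 I o))
    where
    o-child : IsChild I o v
    o-child = child o-leaf
    ts : List (Tour I)
    ts = pairTour o-leaf m-child ∷ []
    C : V I → ℚ
    C = totalCover I ts
    C≥0 : ∀ x → 0ℚ ≤ C x
    C≥0 x = ℚP.+-mono-≤ (Tour.cover≥0 (pairTour o-leaf m-child) x) ℚP.≤-refl
    C-o : C o ≡ dem o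
    C-o with o ≟ o | o ≟ m
    ... | _ | yes o≡m = ⊥-elim (o≢m o≡m)
    ... | yes _ | no _ = trans (ℚP.+-identityʳ _) (ℚP.+-identityʳ _)
    ... | no o≢o | no _ = ⊥-elim (o≢o refl)
    C≤dem : ∀ x → C x ≤ dem x
    C≤dem x with x ≟ o | x ≟ m
    ... | yes refl | yes o≡m = ⊥-elim (o≢m o≡m)
    ... | yes refl | no _ = ℚP.≤-reflexive (trans (ℚP.+-identityʳ _) (ℚP.+-identityʳ _))
    ... | no _ | yes refl = ≤-from-difference (excess (dem o) (dem m)) (ℚP.<⇒≤ (p<q⇒0<q-p 1<pair))
      where
      excess : ∀ a b → b - ((0ℚ + (1ℚ - a)) + 0ℚ) ≡ a + b - 1ℚ
      excess = solve-∀ ℚ-ring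
    ... | no _ | no _ = subst (_≤ dem x) (sym (ℚP.+-identityʳ _)) (dem≥0 x)
    C-outside : ∀ x → ¬ InT I v x → C x ≡ 0ℚ
    C-outside x x∉T with x ≟ o | x ≟ m
    ... | yes refl | _ = ⊥-elim (x∉T (child-InT I o-child))
    ... | no _ | yes refl = ⊥-elim (x∉T (child-InT I m-child))
    ... | no _ | no _ = refl
    covers-inside : ∀ t → t ∈ ts → ∀ x → 0ℚ < Tour.cover t x → InT I v x
    covers-inside t (here refl) x 0<cx with pairCover-visits o m x 0<cx
    ... | here refl = child-InT I o-child
    ... | there (here refl) = child-InT I m-child
    1≤C : 1ℚ ≤ sum C
    1≤C = ℚP.≤-reflexive
      (sym (trans (sum-cong-≗ (λ x → ℚP.+-identityʳ (pairCover o m x))) (sum-pairCover o m)))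
    removed : IsChild I o v × IsLeaf I o × traffic I dem o ≡ ℤ.+ 1 × C o ≡ dem o
    removed = o-child , leaf o-leaf , traffic≡1 o-leaf , C-o

-- Simplified branches

pairwise>1⇒3/2<sum : ∀ a b c → 1ℚ < a + b → 1ℚ < a + c → 1ℚ < b + c → ℤ.+ 3 / 2 < a + b + c
pairwise>1⇒3/2<sum a b c ab ac bc =
  <-from-difference (half-excess a b c) (ℚP.<-respˡ-≡ (ℚP.*-zeroˡ (ℤ.+ 1 / 2)) (ℚP.*-monoˡ-<-pos (ℤ.+ 1 / 2) excess))
  where
  excess : 0ℚ < (a + b) + (a + c) + (b + c) - (1ℚ + 1ℚ + 1ℚ)
  excess = p<q⇒0<q-p (ℚP.+-mono-< (ℚP.+-mono-< ab ac) bc)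
  half-excess : ∀ a b c → a + b + c - ℤ.+ 3 / 2 ≡ ((a + b) + (a + c) + (b + c) - (1ℚ + 1ℚ + 1ℚ)) * (ℤ.+ 1 / 2)
  half-excess = solve-∀ ℚ-ring

three-long⇒sum≥ : ∀ Q l₁ l₂ l₃ →
  Q < (ℤ.+ 3 / 1) * l₁ → Q < (ℤ.+ 3 / 1) * l₂ → Q < (ℤ.+ 3 / 1) * l₃ → Q ≤ l₁ + l₂ + l₃
three-long⇒sum≥ Q l₁ l₂ l₃ long₁ long₂ long₃ =
  ≤-from-difference (average Q l₁ l₂ l₃)
    (nonNeg*nonNeg {ℤ.+ 1 / 3} (ℚP.≤ᵇ⇒≤ _)
      (ℚP.<⇒≤ (ℚP.+-mono-< (ℚP.+-mono-< (p<q⇒0<q-p long₁) (p<q⇒0<q-p long₂)) (p<q⇒0<q-p long₃))))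
  where
  average : ∀ Q a b c → a + b + c - Q ≡
    (ℤ.+ 1 / 3) * (((ℤ.+ 3 / 1) * a - Q) + ((ℤ.+ 3 / 1) * b - Q) + ((ℤ.+ 3 / 1) * c - Q))
  average = solve-∀ ℚ-ring

module _ {n : ℕ} (I : Instance n) (i : Fin n) (simplified : Simplified I (suc i)) where
  open Instance I

  private
    v : V I
    v = suc i

    v∈T : InT I v v
    v∈T = InT-refl I v

  internal-demand≡0 : ¬ IsLeaf I v → dem v ≡ 0ℚ
  internal-demand≡0 = let (rule , _) = simplified in rule v v∈T

  one-branch-child-leaf : ∀ {w} → IsChild I w v → traffic I dem w ≡ ℤ.+ 1 → OneBranchLeaf I i w
  one-branch-child-leaf {w} w-child w-traffic = record
    { child = w-child ; leaf = w-leaf ; traffic≡1 = w-traffic ; dem>0 = proj₁ bounds ; dem<1 = proj₂ bounds }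
    where
    w∈T : InT I v w
    w∈T = child-InT I w-child
    w-leaf : IsLeaf I w
    w-leaf = let (_ , _ , _ , condense , _) = simplified in condense w w∈T w-traffic
    bounds : 0ℚ < dem w × dem w < 1ℚ
    bounds = let (_ , _ , leaf-bounds , _) = simplified in leaf-bounds w w∈T w-leaf

  unite-inapplicable : ∀ {a b} → a ≢ b → IsChild I a v → IsChild I b v → IsLeaf I a → IsLeaf I b →
    1ℚ < dem a + dem b
  unite-inapplicable a≢b a-child b-child a-leaf b-leaf =
    let (_ , _ , _ , _ , _ , _ , unite , _) = simplified
    in ℚP.≰⇒> (unite v v∈T _ _ a-child b-child a-leaf b-leaf a≢b)

  group-inapplicable : 4 ℕ.≤ numChildren I v → ∀ {a b c} → a ≢ b → a ≢ c → b ≢ c →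
    IsChild I a v → IsChild I b v → IsChild I c v → IsLeaf I a → IsLeaf I b → IsLeaf I c →
    ℤ.+ 3 / 2 < dem a + dem b + dem c → 2ℚ ≤ dem a + dem b + dem c
  group-inapplicable four a≢b a≢c b≢c a-child b-child c-child a-leaf b-leaf c-leaf 3/2<S =
    let (_ , _ , _ , _ , _ , group , _) = simplified
    in ℚP.≮⇒≥ (λ S<2 →
         group v v∈T four _ _ _ a-child b-child c-child a-leaf b-leaf c-leaf a≢b a≢c b≢c (3/2<S , S<2))

  unzip-inapplicable : traffic I dem v ≢ sumℤ (map (λ j → traffic I dem (suc j)) (childIdx I v))
  unzip-inapplicable = let (_ , _ , _ , _ , unzip , _) = simplified in unzip v v∈T

  module OneBranchTriple {w₁ w₂ w₃} (w₁≢w₂ : w₁ ≢ w₂) (w₁≢w₃ : w₁ ≢ w₃) (w₂≢w₃ : w₂ ≢ w₃)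
    (leaf₁ : OneBranchLeaf I i w₁) (leaf₂ : OneBranchLeaf I i w₂) (leaf₃ : OneBranchLeaf I i w₃) where

    S : ℚ
    S = dem w₁ + dem w₂ + dem w₃

    pair-sum>1 : ∀ {a b} → a ≢ b → OneBranchLeaf I i a → OneBranchLeaf I i b → 1ℚ < dem a + dem b
    pair-sum>1 a≢b a-leaf b-leaf = unite-inapplicable a≢b (child a-leaf) (child b-leaf) (leaf a-leaf) (leaf b-leaf)

    3/2<S : ℤ.+ 3 / 2 < S
    3/2<S = pairwise>1⇒3/2<sum (dem w₁) (dem w₂) (dem w₃)
      (pair-sum>1 w₁≢w₂ leaf₁ leaf₂) (pair-sum>1 w₁≢w₃ leaf₁ leaf₃) (pair-sum>1 w₂≢w₃ leaf₂ leaf₃)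

    distinct : AllPairs (λ a b → a ≢ b) (w₁ ∷ w₂ ∷ w₃ ∷ [])
    distinct = (w₁≢w₂ ∷ w₁≢w₃ ∷ []) ∷ (w₂≢w₃ ∷ []) ∷ [] ∷ []

    module _ (few : ¬ 4 ℕ.≤ numChildren I v) where

      only-children : ∀ w → IsChild I w v → w ≡ w₁ ⊎ w ≡ w₂ ⊎ w ≡ w₃
      only-children w w-child with w ≟ w₁ | w ≟ w₂ | w ≟ w₃
      ... | yes w≡w₁ | _ | _ = inj₁ w≡w₁
      ... | no _ | yes w≡w₂ | _ = inj₂ (inj₁ w≡w₂)
      ... | no _ | no _ | yes w≡w₃ = inj₂ (inj₂ w≡w₃)
      ... | no w≢w₁ | no w≢w₂ | no w≢w₃ = ⊥-elim (few (length≤numChildren I four-distinct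
            (child leaf₁ ∷ child leaf₂ ∷ child leaf₃ ∷ w-child ∷ [])))
        where
        four-distinct : AllPairs (λ a b → a ≢ b) (w₁ ∷ w₂ ∷ w₃ ∷ w ∷ [])
        four-distinct = (w₁≢w₂ ∷ w₁≢w₃ ∷ ≢-sym w≢w₁ ∷ []) ∷ (w₂≢w₃ ∷ ≢-sym w≢w₂ ∷ []) ∷ (≢-sym w≢w₃ ∷ []) ∷ [] ∷ []

      numChildren≡3 : numChildren I v ≡ 3
      numChildren≡3 = ℕP.≤-antisym (ℕP.≤-pred (ℕP.≰⇒> few))
        (length≤numChildren I distinct (child leaf₁ ∷ child leaf₂ ∷ child leaf₃ ∷ []))

      traffic≡⌈S⌉ : traffic I dem v ≡ ceiling S
      traffic≡⌈S⌉ = cong ceiling (trans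
        (subDem-leaf-children I dem (w₁ ∷ w₂ ∷ w₃ ∷ []) distinct
          (internal-demand≡0 (λ v-leaf → v-leaf w₁ (child leaf₁)))
          ((child leaf₁ , leaf leaf₁) ∷ (child leaf₂ , leaf leaf₂) ∷ (child leaf₃ , leaf leaf₃) ∷ [])
          (λ w w-child → listed (only-children w w-child)))
        (sum-of-three (dem w₁) (dem w₂) (dem w₃)))
        where
        listed : ∀ {w} → w ≡ w₁ ⊎ w ≡ w₂ ⊎ w ≡ w₃ → w ∈ w₁ ∷ w₂ ∷ w₃ ∷ []
        listed (inj₁ w≡w₁) = here w≡w₁
        listed (inj₂ (inj₁ w≡w₂)) = there (here w≡w₂)
        listed (inj₂ (inj₂ w≡w₃)) = there (there (here w≡w₃))
        sum-of-three : ∀ a b c → a + (b + (c + 0ℚ)) ≡ a + b + c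
        sum-of-three = solve-∀ ℚ-ring

      children-traffic≡3 : sumℤ (map (λ j → traffic I dem (suc j)) (childIdx I v)) ≡ ℤ.+ 3
      children-traffic≡3 = trans (sumℤ-map-ones (λ j → traffic I dem (suc j)) (childIdx I v)
          (All.tabulate (λ j∈ → one-branch (only-children _ (_ , refl , proj₂ (∈-filter⁻ (λ j → par j ≟ v)
                                                                              {xs = allFin n} j∈))))))
        (cong ℤ.+_ numChildren≡3)
        where
        one-branch : ∀ {w} → w ≡ w₁ ⊎ w ≡ w₂ ⊎ w ≡ w₃ → traffic I dem w ≡ ℤ.+ 1
        one-branch (inj₁ refl) = traffic≡1 leaf₁
        one-branch (inj₂ (inj₁ refl)) = traffic≡1 leaf₂
        one-branch (inj₂ (inj₂ refl)) = traffic≡1 leaf₃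

      exactly-three-impossible : ¬ Settled I v → ⊥
      exactly-three-impossible unsettled with S ℚP.≤? 2ℚ
      ... | yes S≤2 = unsettled (inj₂ (2 , two-chain))
        where
        1<S : 1ℚ < S
        1<S = subst (_< S) (ℚP.+-identityʳ 1ℚ) (ℚP.+-mono-< (pair-sum>1 w₁≢w₂ leaf₁ leaf₂) (dem>0 leaf₃))
        two-chain : Chain I 2 v
        two-chain =
          simplified , trans traffic≡⌈S⌉ (ceiling-unique S (ℤ.+ 2) (<-from-difference (shift S) (p<q⇒0<q-p 1<S)) S≤2) ,
          w₁ , w₂ , w₃ , (w₁≢w₂ , w₁≢w₃ , w₂≢w₃ , only-children , child leaf₁ , child leaf₂ , child leaf₃) ,
          leaf leaf₁ , leaf leaf₂ , leaf leaf₃ , 3/2<S , S≤2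
          where
          shift : ∀ s → s + 1ℚ - 2ℚ ≡ s - 1ℚ
          shift = solve-∀ ℚ-ring
      ... | no S≰2 = unzip-inapplicable (trans traffic≡⌈S⌉ (trans ⌈S⌉≡3 (sym children-traffic≡3)))
        where
        S≤3 : S ≤ ℤ.+ 3 / 1
        S≤3 = ℚP.<⇒≤ (ℚP.+-mono-< (ℚP.+-mono-< (dem<1 leaf₁) (dem<1 leaf₂)) (dem<1 leaf₃))
        ⌈S⌉≡3 : ceiling S ≡ ℤ.+ 3
        ⌈S⌉≡3 = ceiling-unique S (ℤ.+ 3) (<-from-difference (shift S) (p<q⇒0<q-p (ℚP.≰⇒> S≰2))) S≤3
          where
          shift : ∀ s → s + 1ℚ - ℤ.+ 3 / 1 ≡ s - 2ℚ
          shift = solve-∀ ℚ-ring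

    2≤S : ¬ Settled I v → 2ℚ ≤ S
    2≤S unsettled with 4 ℕ.≤? numChildren I v
    ... | yes four = group-inapplicable four w₁≢w₂ w₁≢w₃ w₂≢w₃ (child leaf₁) (child leaf₂) (child leaf₃)
                       (leaf leaf₁) (leaf leaf₂) (leaf leaf₃) 3/2<S
    ... | no few = ⊥-elim (exactly-three-impossible few unsettled)

    pair-tour : ∀ {o m} → o ≢ m → OneBranchLeaf I i o → OneBranchLeaf I i m →
      (ℤ.+ 3 / 1) * stemLen I m ≤ pathLen I v → Admits I v
    pair-tour o≢m o-leaf m-leaf = admits-by-pair-tour I i o≢m o-leaf (child m-leaf) (pair-sum>1 o≢m o-leaf m-leaf)

    admits : ¬ Settled I v → Admits I v
    admits unsettled with (ℤ.+ 3 / 1) * stemLen I w₁ ℚP.≤? pathLen I v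
                        | (ℤ.+ 3 / 1) * stemLen I w₂ ℚP.≤? pathLen I v
                        | (ℤ.+ 3 / 1) * stemLen I w₃ ℚP.≤? pathLen I v
    ... | yes short₁ | _ | _ = pair-tour (≢-sym w₁≢w₂) leaf₂ leaf₁ short₁
    ... | no _ | yes short₂ | _ = pair-tour w₁≢w₂ leaf₁ leaf₂ short₂
    ... | no _ | no _ | yes short₃ = pair-tour w₁≢w₃ leaf₁ leaf₃ short₃
    ... | no long₁ | no long₂ | no long₃ =
      admits-by-leaf-tours I i w₁≢w₂ w₁≢w₃ w₂≢w₃ leaf₁ leaf₂ leaf₃ (2≤S unsettled)
        (three-long⇒sum≥ (pathLen I v) (stemLen I w₁) (stemLen I w₂) (stemLen I w₃)
          (ℚP.≰⇒> long₁) (ℚP.≰⇒> long₂) (ℚP.≰⇒> long₃))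

-- That the child branches of B are settled is not needed.
lemma8 : ∀ {n : ℕ} (I : Instance n) (i : Fin n) →
    Simplified I (suc i) →
    MinimallyUnsettled I (suc i) →
    ThreeOneBranchChildren I (suc i) →
    Admits I (suc i)
lemma8 I i simplified (unsettled , _)
  (w₁ , w₂ , w₃ , w₁≢w₂ , w₁≢w₃ , w₂≢w₃ , c₁ , c₂ , c₃ , t₁ , t₂ , t₃) =
  OneBranchTriple.admits I i simplified w₁≢w₂ w₁≢w₃ w₂≢w₃
    (one-branch-child-leaf I i simplified c₁ t₁) (one-branch-child-leaf I i simplified c₂ t₂)
    (one-branch-child-leaf I i simplified c₃ t₃) unsettled
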